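{- Let $I=\langle i_n:n\in\omega\rangle$ be an interval partition and let $A\subset\omega$ be such that for each $l\ge 0$ there is $N\in\omega$ such that for every $n\ge N$: (1) $\frac{|A\cap I_n|}{|I_n|}\le 2^{ -l}$; and (2) for all $i,j\in A\cap I_n$ with $i\ne j$, $|i-j|>2^{l-1}$. Then $A$ has asymptotic density $0$, i.e. $\lim_{n\to\infty}|A\cap n|/n=0$.
   Context: An interval partition is a sequence $I=\langle i_n:n\in\omega\rangle\in\omega^\omega$ with $i_0=0$ and $i_n<i_{n+1}$ for all $n$; its $n$th interval is $I_n=[i_n,i_{n+1})=\{k\in\omega:i_n\le k<i_{n+1}\}$. -}

module Defs where

open import Data.Nat using (ℕ; zero; suc; _+_; _∸_; _<_; _≤_)
open import Data.Bool using (Bool; true; false; if_then_else_)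
open import Data.Product using (_×_)
open import Relation.Binary.PropositionalEquality using (_≡_)

Subset : Set
Subset = ℕ → Bool

cntFrom : Subset → ℕ → ℕ → ℕ
cntFrom A a zero    = 0
cntFrom A a (suc m) = (if A a then 1 else 0) + cntFrom A (suc a) m

cntBelow : Subset → ℕ → ℕ
cntBelow A n = cntFrom A 0 n

IsIntervalPartition : (ℕ → ℕ) → Set
IsIntervalPartition i = (i 0 ≡ 0) × (∀ n → i n < i (suc n))

lenI : (ℕ → ℕ) → ℕ → ℕ
lenI i n = i (suc n) ∸ i n

cntI : Subset → (ℕ → ℕ) → ℕ → ℕ
cntI A i n = cntFrom A (i n) (lenI i n)

InI : (ℕ → ℕ) → ℕ → ℕ → Set
InI i n k = (i n ≤ k) × (k < i (suc n))

-- Fix k and take l = k + 3, so d = 2 ^ (l - 1) ≥ 2 (k + 1). From some interval I_N on,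
-- each I_n meets A in at most |I_n| / d points, and these points are more than d
-- apart. For p ∈ I_m with m ≥ N, the whole intervals I_N, …, I_{m-1} contribute at
-- most (i_m - i_N) / d points, and the separation bounds the points of [i_m, p) by
-- (p - i_m) / d + 1. Hence d |A ∩ p| ≤ p + C for a constant C, which is below 2p
-- for large p.
module Submission where

open import Defs
open import Data.Nat using (ℕ; suc; _*_; _^_; _≤_; _<_; ∣_-_∣)
open import Data.Bool using (true)
open import Data.Product using (Σ; _×_)
open import Relation.Binary.PropositionalEquality using (_≡_; _≢_)

open import Data.Nat using (zero; _+_; _∸_; z≤n; s≤s; z<s; _≤′_; ≤′-refl; ≤′-step; _<?_; _≤?_)
open import Data.Nat.Properties
open import Data.Nat.Induction using (<-wellFounded)
open import Induction.WellFounded using (Acc; acc)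
open import Algebra.Properties.CommutativeSemigroup +-commutativeSemigroup
  using () renaming (x∙yz≈y∙xz to m+[n+o]≡n+[m+o])
open import Algebra.Properties.CommutativeSemigroup *-commutativeSemigroup
  using () renaming (x∙yz≈y∙xz to m*[n*o]≡n*[m*o])
open import Data.Bool using (false)
open import Data.Empty using (⊥-elim)
open import Data.Product using (_,_; proj₁; proj₂)
open import Relation.Nullary using (yes; no)
open import Relation.Binary.PropositionalEquality using (refl; sym; cong; subst; module ≡-Reasoning)

n<2^n : ∀ n → n < 2 ^ n
n<2^n zero    = z<s
n<2^n (suc n) = +-mono-≤-< (m^n>0 2 n) (≤-trans (n<2^n n) (m≤m+n (2 ^ n) 0))

∸-telescope : ∀ {a b c} → a ≤ b → b ≤ c → c ∸ a ≡ (b ∸ a) + (c ∸ b)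
∸-telescope {a} {b} {c} a≤b b≤c = begin
  c ∸ a             ≡⟨ cong (_∸ a) (sym (m∸n+n≡m b≤c)) ⟩
  (c ∸ b) + b ∸ a   ≡⟨ +-∸-assoc (c ∸ b) a≤b ⟩
  (c ∸ b) + (b ∸ a) ≡⟨ +-comm (c ∸ b) (b ∸ a) ⟩
  (b ∸ a) + (c ∸ b) ∎
  where open ≡-Reasoning

cntBetween : Subset → ℕ → ℕ → ℕ
cntBetween A a b = cntFrom A a (b ∸ a)

Separated : Subset → ℕ → ℕ → ℕ → Set
Separated A d a b =
  ∀ x y → a ≤ x → y < b → A x ≡ true → A y ≡ true → x < y → x + d < y

module _ (A : Subset) where

  cntFrom-+ : ∀ a m n → cntFrom A a (m + n) ≡ cntFrom A a m + cntFrom A (a + m) n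
  cntFrom-+ a zero    n rewrite +-identityʳ a = refl
  cntFrom-+ a (suc m) n rewrite cntFrom-+ (suc a) m n | +-suc a m =
    sym (+-assoc _ (cntFrom A (suc a) m) (cntFrom A (suc (a + m)) n))

  cntFrom-empty : ∀ a m → (∀ x → a ≤ x → x < a + m → A x ≢ true) → cntFrom A a m ≡ 0
  cntFrom-empty a zero    empty = refl
  cntFrom-empty a (suc m) empty with A a in Aa
  ... | true  = ⊥-elim (empty a ≤-refl (m<m+n a z<s) Aa)
  ... | false = cntFrom-empty (suc a) m λ x a<x x<a+m →
    empty x (<⇒≤ a<x) (subst (x <_) (sym (+-suc a m)) x<a+m)

  cntBetween-trans : ∀ {a b c} → a ≤ b → b ≤ c →
    cntBetween A a c ≡ cntBetween A a b + cntBetween A b c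
  cntBetween-trans {a} {b} {c} a≤b b≤c = begin
    cntFrom A a (c ∸ a)
      ≡⟨ cong (cntFrom A a) (∸-telescope a≤b b≤c) ⟩
    cntFrom A a ((b ∸ a) + (c ∸ b))
      ≡⟨ cntFrom-+ a (b ∸ a) (c ∸ b) ⟩
    cntBetween A a b + cntFrom A (a + (b ∸ a)) (c ∸ b)
      ≡⟨ cong (λ z → cntBetween A a b + cntFrom A z (c ∸ b)) (m+[n∸m]≡n a≤b) ⟩
    cntBetween A a b + cntBetween A b c ∎
    where open ≡-Reasoning

  cntBetween-*-≤-+ : ∀ {a b c d x y} → a ≤ b → b ≤ c →
    cntBetween A a b * d ≤ x → cntBetween A b c * d ≤ y → cntBetween A a c * d ≤ x + y
  cntBetween-*-≤-+ {a} {b} {c} {d} a≤b b≤c ≤x ≤y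
    rewrite cntBetween-trans a≤b b≤c | *-distribʳ-+ d (cntBetween A a b) (cntBetween A b c) =
    +-mono-≤ ≤x ≤y

  Separated-mono : ∀ {d a a′ b b′} → a ≤ a′ → b′ ≤ b → Separated A d a b → Separated A d a′ b′
  Separated-mono a≤a′ b′≤b sep x y a′≤x y<b′ =
    sep x y (≤-trans a≤a′ a′≤x) (<-≤-trans y<b′ b′≤b)

  Separated⇒gap-empty : ∀ {d a b} → Separated A d a b → A a ≡ true →
    ∀ m → m ≤ d → suc a + m ≤ b → cntFrom A (suc a) m ≡ 0
  Separated⇒gap-empty {d} {a} sep Aa m m≤d a+m<b =
    cntFrom-empty (suc a) m λ y a<y y≤a+m Ay →
      <⇒≱ (sep a y ≤-refl (<-≤-trans y≤a+m a+m<b) Aa Ay a<y)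
          (≤-trans (≤-pred y≤a+m) (+-monoʳ-≤ a m≤d))

  -- After a point of A the next d positions are empty, so the recursion skips
  -- d + 1 positions at once: it is well-founded rather than structural.
  cntFrom-separated : ∀ {d} a L → Acc _<_ L → Separated A d a (a + L) →
    cntFrom A a L * d ≤ L + d
  cntFrom-separated a zero _ _ = z≤n
  cntFrom-separated {d} a (suc L) (acc rec) sep with A a in Aa
  ... | false = ≤-trans
    (cntFrom-separated (suc a) L (rec ≤-refl)
      (Separated-mono (n≤1+n a) (≤-reflexive (sym (+-suc a L))) sep))
    (+-monoˡ-≤ d (n≤1+n L))
  ... | true with L ≤? d
  ...   | yes L≤d = begin
    (1 + cntFrom A (suc a) L) * d
      ≡⟨ cong (λ c → (1 + c) * d) (Separated⇒gap-empty sep Aa L L≤d (≤-reflexive (sym (+-suc a L)))) ⟩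
    d + 0
      ≡⟨ +-identityʳ d ⟩
    d
      ≤⟨ m≤n+m d (suc L) ⟩
    suc L + d ∎
    where open ≤-Reasoning
  ...   | no L≰d = begin
    (1 + cntFrom A (suc a) L) * d
      ≡⟨ cong (λ c → (1 + c) * d) rest-after-gap ⟩
    d + cntFrom A (suc a + d) R * d
      ≤⟨ +-monoʳ-≤ d (cntFrom-separated (suc a + d) R (rec (s≤s (m∸n≤m L d)))
           (Separated-mono (≤-trans (n≤1+n a) (m≤m+n (suc a) d)) (≤-reflexive end-of-window) sep)) ⟩
    d + (R + d)
      ≡⟨ cong (d +_) (m∸n+n≡m d≤L) ⟩
    d + L
      ≤⟨ +-monoʳ-≤ d (n≤1+n L) ⟩
    d + suc L
      ≡⟨ +-comm d (suc L) ⟩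
    suc L + d ∎
    where
    open ≤-Reasoning
    R = L ∸ d
    d≤L : d ≤ L
    d≤L = <⇒≤ (≰⇒> L≰d)
    end-of-window : suc a + d + R ≡ a + suc L
    end-of-window = begin-equality
      suc a + d + R   ≡⟨ +-assoc (suc a) d R ⟩
      suc a + (d + R) ≡⟨ cong (suc a +_) (m+[n∸m]≡n d≤L) ⟩
      suc a + L       ≡⟨ sym (+-suc a L) ⟩
      a + suc L       ∎
    rest-after-gap : cntFrom A (suc a) L ≡ cntFrom A (suc a + d) R
    rest-after-gap = begin-equality
      cntFrom A (suc a) L
        ≡⟨ cong (cntFrom A (suc a)) (sym (m+[n∸m]≡n d≤L)) ⟩
      cntFrom A (suc a) (d + R)
        ≡⟨ cntFrom-+ (suc a) d R ⟩
      cntFrom A (suc a) d + cntFrom A (suc a + d) R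
        ≡⟨ cong (_+ cntFrom A (suc a + d) R)
             (Separated⇒gap-empty sep Aa d ≤-refl (≤-trans (+-monoʳ-≤ (suc a) d≤L) (≤-reflexive (sym (+-suc a L))))) ⟩
      cntFrom A (suc a + d) R ∎

  cntBetween-separated : ∀ {d a b} → a ≤ b → Separated A d a b →
    cntBetween A a b * d ≤ (b ∸ a) + d
  cntBetween-separated {a = a} {b} a≤b sep =
    cntFrom-separated a (b ∸ a) (<-wellFounded (b ∸ a))
      (Separated-mono ≤-refl (≤-reflexive (m+[n∸m]≡n a≤b)) sep)

  dist⇒Separated : ∀ {d a b} →
    (∀ x y → (a ≤ x × x < b) → (a ≤ y × y < b) → A x ≡ true → A y ≡ true → x ≢ y →
      d < ∣ x - y ∣) →
    Separated A d a b
  dist⇒Separated {d} far x y a≤x y<b Ax Ay x<y =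
    subst (x + d <_) (m+[n∸m]≡n (<⇒≤ x<y)) (+-monoʳ-< x d<y∸x)
    where
    d<y∸x : d < y ∸ x
    d<y∸x = subst (d <_) (m≤n⇒∣m-n∣≡n∸m (<⇒≤ x<y))
      (far x y (a≤x , <-trans x<y y<b) (≤-trans a≤x (<⇒≤ x<y) , y<b) Ax Ay (<⇒≢ x<y))

  cntBelow-*-≤-p+p : ∀ {a d} → (∀ p → a ≤ p → cntBetween A a p * d ≤ (p ∸ a) + d) →
    ∀ p → a + (cntBelow A a * d + d) ≤ p → cntBelow A p * d ≤ p + p
  cntBelow-*-≤-p+p {a} {d} tail p large = begin
    cntBelow A p * d
      ≤⟨ cntBetween-*-≤-+ z≤n a≤p ≤-refl (tail p a≤p) ⟩
    cntBelow A a * d + ((p ∸ a) + d)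
      ≡⟨ m+[n+o]≡n+[m+o] (cntBelow A a * d) (p ∸ a) d ⟩
    (p ∸ a) + (cntBelow A a * d + d)
      ≤⟨ +-mono-≤ (m∸n≤m p a) (≤-trans (m≤n+m _ a) large) ⟩
    p + p ∎
    where
    open ≤-Reasoning
    a≤p : a ≤ p
    a≤p = ≤-trans (m≤m+n a _) large

module _ {i : ℕ → ℕ} (ip : IsIntervalPartition i) where

  i-mono-≤′ : ∀ {m n} → m ≤′ n → i m ≤ i n
  i-mono-≤′ ≤′-refl         = ≤-refl
  i-mono-≤′ (≤′-step m≤′n) = ≤-trans (i-mono-≤′ m≤′n) (<⇒≤ (proj₂ ip _))

  i-mono-≤ : ∀ {m n} → m ≤ n → i m ≤ i n
  i-mono-≤ m≤n = i-mono-≤′ (≤⇒≤′ m≤n)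

  n≤i[n] : ∀ n → n ≤ i n
  n≤i[n] zero    = z≤n
  n≤i[n] (suc n) = <-≤-trans (s≤s (n≤i[n] n)) (proj₂ ip n)

  ∃-interval : ∀ N p → i N ≤ p → Σ ℕ λ m → N ≤ m × InI i m p
  ∃-interval N p i[N]≤p = search (suc p) (<-≤-trans (s≤s (m≤m+n p N)) (n≤i[n] (suc p + N)))
    where
    search : ∀ t → p < i (t + N) → Σ ℕ λ m → N ≤ m × InI i m p
    search zero    p<i[N] = ⊥-elim (<⇒≱ p<i[N] i[N]≤p)
    search (suc t) p<i[t+N+1] with p <? i (t + N)
    ... | yes p<i[t+N] = search t p<i[t+N]
    ... | no  p≮i[t+N] = t + N , m≤n+m N t , ≮⇒≥ p≮i[t+N] , p<i[t+N+1]

  module _ (A : Subset) {d N : ℕ}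
    (sparse : ∀ n → N ≤ n → cntI A i n * d ≤ lenI i n)
    (separated : ∀ n → N ≤ n → Separated A d (i n) (i (suc n))) where

    cntBetween-intervals : ∀ {n} → N ≤′ n → cntBetween A (i N) (i n) * d ≤ i n ∸ i N
    cntBetween-intervals ≤′-refl rewrite n∸n≡0 (i N) = z≤n
    cntBetween-intervals {suc n} (≤′-step N≤′n) = begin
      cntBetween A (i N) (i (suc n)) * d
        ≤⟨ cntBetween-*-≤-+ A i[N]≤i[n] i[n]≤i[n+1]
             (cntBetween-intervals N≤′n) (sparse n (≤′⇒≤ N≤′n)) ⟩
      (i n ∸ i N) + lenI i n
        ≡⟨ sym (∸-telescope i[N]≤i[n] i[n]≤i[n+1]) ⟩
      i (suc n) ∸ i N ∎
      where
      open ≤-Reasoning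
      i[N]≤i[n] = i-mono-≤′ N≤′n
      i[n]≤i[n+1] = <⇒≤ (proj₂ ip n)

    cntBetween-tail : ∀ p → i N ≤ p → cntBetween A (i N) p * d ≤ (p ∸ i N) + d
    cntBetween-tail p i[N]≤p with ∃-interval N p i[N]≤p
    ... | m , N≤m , i[m]≤p , p<i[m+1] = begin
      cntBetween A (i N) p * d
        ≤⟨ cntBetween-*-≤-+ A i[N]≤i[m] i[m]≤p
             (cntBetween-intervals (≤⇒≤′ N≤m))
             (cntBetween-separated A i[m]≤p
               (Separated-mono A ≤-refl (<⇒≤ p<i[m+1]) (separated m N≤m))) ⟩
      (i m ∸ i N) + ((p ∸ i m) + d)
        ≡⟨ sym (+-assoc (i m ∸ i N) (p ∸ i m) d) ⟩
      (i m ∸ i N) + (p ∸ i m) + d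
        ≡⟨ cong (_+ d) (sym (∸-telescope i[N]≤i[m] i[m]≤p)) ⟩
      (p ∸ i N) + d ∎
      where
      open ≤-Reasoning
      i[N]≤i[m] = i-mono-≤ N≤m

lemma2p2 : (i : ℕ → ℕ) → IsIntervalPartition i → (A : Subset) →
    ((l : ℕ) → Σ ℕ (λ N → (n : ℕ) → N ≤ n →
    (cntI A i n * 2 ^ l ≤ lenI i n) ×
    ((a b : ℕ) → InI i n a → InI i n b → A a ≡ true → A b ≡ true → a ≢ b →
    2 ^ l < 2 * ∣ a - b ∣))) →
    (k : ℕ) → Σ ℕ (λ N → (n : ℕ) → N ≤ n → cntBelow A n * suc k ≤ n)
lemma2p2 i ip A H k = i N + (cntBelow A (i N) * d + d) , λ p large → *-cancelˡ-≤ 2 (begin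
  2 * (cntBelow A p * K) ≡⟨ m*[n*o]≡n*[m*o] 2 (cntBelow A p) K ⟩
  cntBelow A p * (2 * K) ≤⟨ *-monoʳ-≤ (cntBelow A p) (*-monoʳ-≤ 2 (<⇒≤ (n<2^n K))) ⟩
  cntBelow A p * d       ≤⟨ cntBelow-*-≤-p+p A (cntBetween-tail ip A sparse separated) p large ⟩
  p + p                  ≡⟨ cong (p +_) (sym (+-identityʳ p)) ⟩
  2 * p                  ∎)
  where
  open ≤-Reasoning
  K = suc k
  l = suc (suc K)
  d = 2 ^ suc K
  N = proj₁ (H l)
  sparse : ∀ n → N ≤ n → cntI A i n * d ≤ lenI i n
  sparse n N≤n =
    ≤-trans (*-monoʳ-≤ (cntI A i n) (m≤m+n d (d + 0))) (proj₁ (proj₂ (H l) n N≤n))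
  separated : ∀ n → N ≤ n → Separated A d (i n) (i (suc n))
  separated n N≤n = dist⇒Separated A λ x y x∈I y∈I Ax Ay x≢y →
    *-cancelˡ-< 2 d ∣ x - y ∣ (proj₂ (proj₂ (H l) n N≤n) x y x∈I y∈I Ax Ay x≢y)
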